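{- Let $r,\kappa\ge 2$ be integers and suppose that $S\subseteq\mathbb{F}_2^r$ is a sum-free set with $|S|>2^{r-2}+\kappa$. Then every element of $2S$ has at least $\kappa$ representations as a sum of two elements of $S$, where representations differing only by the order of the summands are counted as the same.
   Context: $\mathbb{F}_2^r$ denotes the elementary abelian $2$-group of rank $r$. For $X\subseteq\mathbb{F}_2^r$, $2X:=\{x_1+x_2\colon x_1,x_2\in X\}$ (with $x_1=x_2$ allowed); $X$ is sum-free if $X\cap 2X=\varnothing$. -}

module Defs where

open import Data.Bool using (Bool; true; false; _xor_; _∧_; _∨_; not; T)
open import Data.Nat using (ℕ; zero; suc)
open import Data.Vec using (Vec; []; _∷_; zipWith; replicate)
open import Data.List using (List; []; _∷_; map; concatMap; filterᵇ; length; cartesianProduct)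
open import Data.Product using (_×_; _,_; proj₁; proj₂; ∃; ∃-syntax)
open import Relation.Binary.PropositionalEquality using (_≡_)

F₂^ : ℕ → Set
F₂^ r = Vec Bool r

_⊕_ : ∀ {r} → F₂^ r → F₂^ r → F₂^ r
_⊕_ = zipWith _xor_

_==_ : ∀ {r} → F₂^ r → F₂^ r → Bool
[] == [] = true
(a ∷ x) == (b ∷ y) = not (a xor b) ∧ (x == y)

-- Strict lexicographic order (Boolean), used to pick one ordering of an unordered pair.
_<ᵇ_ : ∀ {r} → F₂^ r → F₂^ r → Bool
[] <ᵇ [] = false
(a ∷ x) <ᵇ (b ∷ y) = (not a ∧ b) ∨ (not (a xor b) ∧ (x <ᵇ y))

_≤ᵇ_ : ∀ {r} → F₂^ r → F₂^ r → Bool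
x ≤ᵇ y = (x <ᵇ y) ∨ (x == y)

allVecs : (r : ℕ) → List (F₂^ r)
allVecs zero = [] ∷ []
allVecs (suc r) = map (false ∷_) (allVecs r) Data.List.++ map (true ∷_) (allVecs r)

Subset : ℕ → Set
Subset r = F₂^ r → Bool

_∈_ : ∀ {r} → F₂^ r → Subset r → Set
x ∈ S = T (S x)

∣_∣ : ∀ {r} → Subset r → ℕ
∣_∣ {r} S = length (filterᵇ S (allVecs r))

_∈2_ : ∀ {r} → F₂^ r → Subset r → Set
z ∈2 S = ∃[ x ] ∃[ y ] (x ∈ S × y ∈ S × (x ⊕ y) ≡ z)

SumFree : ∀ {r} → Subset r → Set
SumFree S = ∀ z → z ∈ S → z ∈2 S → Data.Empty.⊥
  where import Data.Empty

-- Number of unordered representations z = x + y with x, y ∈ S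
-- ({x,y} counted once: we count pairs (x , y) with x ≤ y lexicographically).
reps : ∀ {r} → Subset r → F₂^ r → ℕ
reps {r} S z = length (filterᵇ ok (cartesianProduct (allVecs r) (allVecs r)))
  where
  ok : F₂^ r × F₂^ r → Bool
  ok (x , y) = S x ∧ S y ∧ (x ≤ᵇ y) ∧ ((x ⊕ y) == z)

module Submission where

-- Let z = a ⊕ b with a, b ∈ S and consider the translate S ⊕ z together with
--   T = S ∪ (S ⊕ z)   and   Q = S ∩ (S ⊕ z).
--   (1) |S| + |S| = |T| + |Q|, by inclusion–exclusion and |S ⊕ z| = |S|.
--   (2) T is disjoint from its translate T ⊕ a because S is sum-free; hence 2|T| ≤ 2^r.
--   (3) Q consists of the x ∈ S with x ⊕ z ∈ S; each such x is the smaller or the larger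
--       summand of a representation z = x + (x ⊕ z), so |Q| ≤ 2·#{smaller summands}.
--   (4) Distinct smaller summands give distinct representations, so #{smaller} ≤ reps S z.
-- Hence 4|S| ≤ 2^r + 4·reps S z ≤ 4·2^(r-2) + 4·reps S z, so |S| ≤ 2^(r-2) + reps S z for
-- every r, and the corollary follows.

open import Defs
open import Data.Bool using (Bool; true; false; _xor_; _∧_; _∨_; T; if_then_else_)
open import Data.Bool.Properties using (xor-assoc; xor-comm; xor-same; xor-identityʳ; T-∧; T-∨)
open import Data.Empty using (⊥; ⊥-elim)
open import Data.List using (List; []; _∷_; map; filterᵇ; length; cartesianProduct; _++_)
open import Data.List.Membership.Propositional using () renaming (_∈_ to _∈ₗ_)
open import Data.List.Membership.Propositional.Properties
  using (∈-++⁺ˡ; ∈-++⁺ʳ; ∈-map⁺; ∈-filter⁺; ∈-length)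
open import Data.List.Properties using (filter-++; length-++)
open import Data.List.Relation.Unary.Any using (here)
open import Data.Nat using (ℕ; zero; suc; _≤_; _<_; _+_; _*_; _^_; _∸_; z≤n; s≤s)
open import Data.Nat.Properties
open import Algebra.Properties.CommutativeSemigroup +-commutativeSemigroup using (interchange)
open import Data.Nat.Tactic.RingSolver using (solve-∀)
open import Data.Product using (_×_; _,_)
open import Data.Sum using (inj₁; inj₂)
open import Data.Unit using (tt)
open import Data.Vec using ([]; _∷_)
open import Data.Vec.Relation.Binary.Pointwise.Inductive using (Pointwise-≡⇒≡; zipWith-assoc; zipWith-comm)
open import Function using (_∘_; Equivalence)
open import Relation.Binary.PropositionalEquality
open import Relation.Nullary.Decidable using (T?)

open Equivalence using (to)

length-filter-++ : ∀ {A : Set} (p : A → Bool) (xs ys : List A) →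
  length (filterᵇ p (xs ++ ys)) ≡ length (filterᵇ p xs) + length (filterᵇ p ys)
length-filter-++ p xs ys = trans (cong length (filter-++ (T? ∘ p) xs ys)) (length-++ (filterᵇ p xs))

length-filter-map : ∀ {A B : Set} (p : B → Bool) (f : A → B) (xs : List A) →
  length (filterᵇ p (map f xs)) ≡ length (filterᵇ (p ∘ f) xs)
length-filter-map p f [] = refl
length-filter-map p f (x ∷ xs) with p (f x)
... | true  = cong suc (length-filter-map p f xs)
... | false = length-filter-map p f xs

-- In a product list, the row of x contains the pair (x , f x) whenever f x ∈ ys; so
-- filtering the product retains at least as many pairs as there are x with ok (x , f x).
filter-graph-≤ : ∀ {A B : Set} (ok : A × B → Bool) (f : A → B) (xs : List A) (ys : List B) →
  (∀ x → f x ∈ₗ ys) →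
  length (filterᵇ (λ x → ok (x , f x)) xs) ≤ length (filterᵇ ok (cartesianProduct xs ys))
filter-graph-≤ ok f [] ys f∈ys = z≤n
filter-graph-≤ ok f (x ∷ xs) ys f∈ys =
  ≤-trans row-then-rest (≤-reflexive (sym (length-filter-++ ok (map (x ,_) ys) (cartesianProduct xs ys))))
  where
  rest : length (filterᵇ (λ x → ok (x , f x)) xs) ≤ length (filterᵇ ok (cartesianProduct xs ys))
  rest = filter-graph-≤ ok f xs ys f∈ys

  row-nonempty : T (ok (x , f x)) → 1 ≤ length (filterᵇ ok (map (x ,_) ys))
  row-nonempty okx = ∈-length (∈-filter⁺ (T? ∘ ok) (∈-map⁺ (x ,_) (f∈ys x)) okx)

  row-then-rest : length (filterᵇ (λ x → ok (x , f x)) (x ∷ xs)) ≤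
                  length (filterᵇ ok (map (x ,_) ys)) + length (filterᵇ ok (cartesianProduct xs ys))
  row-then-rest with ok (x , f x) in okx
  ... | true  = +-mono-≤ (row-nonempty (subst T (sym okx) tt)) rest
  ... | false = ≤-trans rest (m≤n+m _ _)

allVecs-complete : ∀ r (v : F₂^ r) → v ∈ₗ allVecs r
allVecs-complete zero    []          = here refl
allVecs-complete (suc r) (false ∷ v) = ∈-++⁺ˡ (∈-map⁺ (false ∷_) (allVecs-complete r v))
allVecs-complete (suc r) (true ∷ v)  =
  ∈-++⁺ʳ (map (false ∷_) (allVecs r)) (∈-map⁺ (true ∷_) (allVecs-complete r v))

-- The number of points of F₂^r satisfying P, computed by splitting on the first coordinate;
-- this recursive form makes the counting lemmas below straightforward inductions.
count : ∀ {r} → Subset r → ℕ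
count {zero}  P = if P [] then 1 else 0
count {suc r} P = count (λ v → P (false ∷ v)) + count (λ v → P (true ∷ v))

count-correct : ∀ {r} (P : Subset r) → count P ≡ ∣ P ∣
count-correct {zero} P with P []
... | true  = refl
... | false = refl
count-correct {suc r} P = begin
  count (λ v → P (false ∷ v)) + count (λ v → P (true ∷ v))
    ≡⟨ cong₂ _+_ (count-correct (λ v → P (false ∷ v))) (count-correct (λ v → P (true ∷ v))) ⟩
  ∣ (λ v → P (false ∷ v)) ∣ + ∣ (λ v → P (true ∷ v)) ∣
    ≡⟨ sym (cong₂ _+_ (length-filter-map P (false ∷_) (allVecs r))
                      (length-filter-map P (true ∷_) (allVecs r))) ⟩
  length (filterᵇ P (map (false ∷_) (allVecs r))) + length (filterᵇ P (map (true ∷_) (allVecs r)))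
    ≡⟨ sym (length-filter-++ P (map (false ∷_) (allVecs r)) (map (true ∷_) (allVecs r))) ⟩
  ∣ P ∣ ∎
  where open ≡-Reasoning

count-mono : ∀ {r} {P Q : Subset r} → (∀ x → x ∈ P → x ∈ Q) → count P ≤ count Q
count-mono {zero} {P} {Q} P⊆Q with P [] | Q [] | P⊆Q []
... | false | _     | _   = z≤n
... | true  | true  | _   = ≤-refl
... | true  | false | P⊈Q = ⊥-elim (P⊈Q tt)
count-mono {suc r} P⊆Q = +-mono-≤ (count-mono (P⊆Q ∘ (false ∷_))) (count-mono (P⊆Q ∘ (true ∷_)))

count-empty : ∀ {r} {P : Subset r} → (∀ x → x ∈ P → ⊥) → count P ≡ 0
count-empty {zero} {P} P-empty with P [] | P-empty []
... | false | _      = refl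
... | true  | notInP = ⊥-elim (notInP tt)
count-empty {suc r} P-empty =
  cong₂ _+_ (count-empty (P-empty ∘ (false ∷_))) (count-empty (P-empty ∘ (true ∷_)))

count-≤-2^ : ∀ {r} (P : Subset r) → count P ≤ 2 ^ r
count-≤-2^ {zero} P with P []
... | true  = ≤-refl
... | false = z≤n
count-≤-2^ {suc r} P = subst (count P ≤_) (cong (2 ^ r +_) (sym (+-identityʳ (2 ^ r))))
  (+-mono-≤ (count-≤-2^ (λ v → P (false ∷ v))) (count-≤-2^ (λ v → P (true ∷ v))))

count-union-inter : ∀ {r} (P Q : Subset r) →
  count P + count Q ≡ count (λ x → P x ∨ Q x) + count (λ x → P x ∧ Q x)
count-union-inter {zero} P Q with P [] | Q []
... | true  | true  = refl
... | true  | false = refl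
... | false | true  = refl
... | false | false = refl
count-union-inter {suc r} P Q = begin
  (count P₀ + count P₁) + (count Q₀ + count Q₁)
    ≡⟨ interchange (count P₀) (count P₁) (count Q₀) (count Q₁) ⟩
  (count P₀ + count Q₀) + (count P₁ + count Q₁)
    ≡⟨ cong₂ _+_ (count-union-inter P₀ Q₀) (count-union-inter P₁ Q₁) ⟩
  (count (∪ P₀ Q₀) + count (∩ P₀ Q₀)) + (count (∪ P₁ Q₁) + count (∩ P₁ Q₁))
    ≡⟨ interchange (count (∪ P₀ Q₀)) (count (∩ P₀ Q₀)) (count (∪ P₁ Q₁)) (count (∩ P₁ Q₁)) ⟩
  (count (∪ P₀ Q₀) + count (∪ P₁ Q₁)) + (count (∩ P₀ Q₀) + count (∩ P₁ Q₁)) ∎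
  where
  open ≡-Reasoning
  P₀ P₁ Q₀ Q₁ : Subset r
  P₀ v = P (false ∷ v)
  P₁ v = P (true ∷ v)
  Q₀ v = Q (false ∷ v)
  Q₁ v = Q (true ∷ v)
  ∪ ∩ : Subset r → Subset r → Subset r
  ∪ P Q x = P x ∨ Q x
  ∩ P Q x = P x ∧ Q x

-- Translation by c permutes F₂^r, so it preserves cardinalities.
count-translate : ∀ {r} (P : Subset r) (c : F₂^ r) → count (λ x → P (x ⊕ c)) ≡ count P
count-translate {zero} P [] = refl
count-translate {suc r} P (false ∷ c) =
  cong₂ _+_ (count-translate (λ v → P (false ∷ v)) c) (count-translate (λ v → P (true ∷ v)) c)
count-translate {suc r} P (true ∷ c) = begin
  count (λ v → P (true ∷ (v ⊕ c))) + count (λ v → P (false ∷ (v ⊕ c)))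
    ≡⟨ cong₂ _+_ (count-translate (λ v → P (true ∷ v)) c) (count-translate (λ v → P (false ∷ v)) c) ⟩
  count (λ v → P (true ∷ v)) + count (λ v → P (false ∷ v))
    ≡⟨ +-comm (count (λ v → P (true ∷ v))) _ ⟩
  count P ∎
  where open ≡-Reasoning

count-union-translate : ∀ {r} (P : Subset r) (c : F₂^ r) →
  count (λ x → P x ∨ P (x ⊕ c)) ≤ count P + count P
count-union-translate P c = begin
  count (λ x → P x ∨ P (x ⊕ c))                                   ≤⟨ m≤m+n _ _ ⟩
  count (λ x → P x ∨ P (x ⊕ c)) + count (λ x → P x ∧ P (x ⊕ c))  ≡⟨ sym (count-union-inter P (λ x → P (x ⊕ c))) ⟩
  count P + count (λ x → P (x ⊕ c))                               ≡⟨ cong (count P +_) (count-translate P c) ⟩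
  count P + count P                                               ∎
  where open ≤-Reasoning

count-disjoint-translate : ∀ {r} (P : Subset r) (c : F₂^ r) →
  (∀ x → x ∈ P → (x ⊕ c) ∈ P → ⊥) → count P + count P ≤ 2 ^ r
count-disjoint-translate {r} P c disjoint = begin
  count P + count P                                               ≡⟨ cong (count P +_) (sym (count-translate P c)) ⟩
  count P + count (λ x → P (x ⊕ c))                               ≡⟨ count-union-inter P (λ x → P (x ⊕ c)) ⟩
  count (λ x → P x ∨ P (x ⊕ c)) + count (λ x → P x ∧ P (x ⊕ c))  ≡⟨ cong (count (λ x → P x ∨ P (x ⊕ c)) +_) (count-empty meet-empty) ⟩
  count (λ x → P x ∨ P (x ⊕ c)) + 0                               ≡⟨ +-identityʳ _ ⟩
  count (λ x → P x ∨ P (x ⊕ c))                                   ≤⟨ count-≤-2^ (λ x → P x ∨ P (x ⊕ c)) ⟩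
  2 ^ r                                                           ∎
  where
  open ≤-Reasoning
  meet-empty : ∀ x → T (P x ∧ P (x ⊕ c)) → ⊥
  meet-empty x x∈P∩P⊕c with to T-∧ x∈P∩P⊕c
  ... | x∈P , xc∈P = disjoint x x∈P xc∈P

⊕-assoc : ∀ {r} (x y w : F₂^ r) → (x ⊕ y) ⊕ w ≡ x ⊕ (y ⊕ w)
⊕-assoc x y w = Pointwise-≡⇒≡ (zipWith-assoc xor-assoc x y w)

⊕-comm : ∀ {r} (x y : F₂^ r) → x ⊕ y ≡ y ⊕ x
⊕-comm x y = Pointwise-≡⇒≡ (zipWith-comm xor-comm x y)

⊕-cancelʳ : ∀ {r} (x c : F₂^ r) → (x ⊕ c) ⊕ c ≡ x
⊕-cancelʳ []      []      = refl
⊕-cancelʳ (a ∷ x) (b ∷ c) =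
  cong₂ _∷_ (trans (xor-assoc a b b) (trans (cong (a xor_) (xor-same b)) (xor-identityʳ a)))
            (⊕-cancelʳ x c)

⊕-cancelˡ : ∀ {r} (c x : F₂^ r) → c ⊕ (c ⊕ x) ≡ x
⊕-cancelˡ c x = begin
  c ⊕ (c ⊕ x)  ≡⟨ ⊕-comm c (c ⊕ x) ⟩
  (c ⊕ x) ⊕ c  ≡⟨ cong (_⊕ c) (⊕-comm c x) ⟩
  (x ⊕ c) ⊕ c  ≡⟨ ⊕-cancelʳ x c ⟩
  x            ∎
  where open ≡-Reasoning

⊕-swapʳ : ∀ {r} (x y w : F₂^ r) → (x ⊕ y) ⊕ w ≡ (x ⊕ w) ⊕ y
⊕-swapʳ x y w = begin
  (x ⊕ y) ⊕ w  ≡⟨ ⊕-assoc x y w ⟩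
  x ⊕ (y ⊕ w)  ≡⟨ cong (x ⊕_) (⊕-comm y w) ⟩
  x ⊕ (w ⊕ y)  ≡⟨ sym (⊕-assoc x w y) ⟩
  (x ⊕ w) ⊕ y  ∎
  where open ≡-Reasoning

==-refl : ∀ {r} (v : F₂^ r) → T (v == v)
==-refl []          = tt
==-refl (true ∷ v)  = ==-refl v
==-refl (false ∷ v) = ==-refl v

≤ᵇ-total : ∀ {r} (x y : F₂^ r) → T ((x ≤ᵇ y) ∨ (y ≤ᵇ x))
≤ᵇ-total []          []          = tt
≤ᵇ-total (true ∷ x)  (true ∷ y)  = ≤ᵇ-total x y
≤ᵇ-total (false ∷ x) (false ∷ y) = ≤ᵇ-total x y
≤ᵇ-total (true ∷ x)  (false ∷ y) = tt
≤ᵇ-total (false ∷ x) (true ∷ y)  = tt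

-- In a sum-free set S, translating an element of S by an element of S leaves S,
-- since u = (u ⊕ c) ⊕ c would lie in S ∩ 2S.
sumFree-translate : ∀ {r} {S : Subset r} {u c : F₂^ r} →
  SumFree S → c ∈ S → u ∈ S → (u ⊕ c) ∈ S → ⊥
sumFree-translate {u = u} {c} sumFree c∈S u∈S uc∈S = sumFree u u∈S (u ⊕ c , c , uc∈S , c∈S , ⊕-cancelʳ u c)

translateUnion : ∀ {r} → Subset r → F₂^ r → Subset r
translateUnion S z x = S x ∨ S (x ⊕ z)

translateInter : ∀ {r} → Subset r → F₂^ r → Subset r
translateInter S z x = S x ∧ S (x ⊕ z)

-- The smaller summands of z: the x ∈ S with x ⊕ z ∈ S and x ≤ x ⊕ z lexicographically,
-- i.e. the first components of the representations counted by reps S z.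
smallerSummand : ∀ {r} → Subset r → F₂^ r → Subset r
smallerSummand S z x = S x ∧ S (x ⊕ z) ∧ (x ≤ᵇ (x ⊕ z))

count-twice : ∀ {r} (S : Subset r) (z : F₂^ r) →
  count S + count S ≡ count (translateUnion S z) + count (translateInter S z)
count-twice S z = trans (cong (count S +_) (sym (count-translate S z))) (count-union-inter S (λ x → S (x ⊕ z)))

-- Step (2): for a, b ∈ S and S sum-free, S ∪ (S ⊕ (a ⊕ b)) is disjoint from its
-- translate by a; each of the four cases exhibits an element of S translated by a or b inside S.
translateUnion-disjoint : ∀ {r} {S : Subset r} {a b : F₂^ r} → SumFree S → a ∈ S → b ∈ S →
  ∀ x → x ∈ translateUnion S (a ⊕ b) → (x ⊕ a) ∈ translateUnion S (a ⊕ b) → ⊥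
translateUnion-disjoint {S = S} {a} {b} sumFree a∈S b∈S x x∈U xa∈U with to T-∨ x∈U | to T-∨ xa∈U
... | inj₁ x∈S | inj₁ xa∈S = sumFree-translate sumFree a∈S x∈S xa∈S
... | inj₁ x∈S | inj₂ xaz∈S = sumFree-translate sumFree b∈S x∈S (subst (_∈ S) xaz≡xb xaz∈S)
  where
  xaz≡xb : (x ⊕ a) ⊕ (a ⊕ b) ≡ x ⊕ b
  xaz≡xb = trans (sym (⊕-assoc (x ⊕ a) a b)) (cong (_⊕ b) (⊕-cancelʳ x a))
... | inj₂ xz∈S | inj₁ xa∈S = sumFree-translate sumFree b∈S xz∈S (subst (_∈ S) (sym xzb≡xa) xa∈S)
  where
  xzb≡xa : (x ⊕ (a ⊕ b)) ⊕ b ≡ x ⊕ a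
  xzb≡xa = trans (cong (_⊕ b) (sym (⊕-assoc x a b))) (⊕-cancelʳ (x ⊕ a) b)
... | inj₂ xz∈S | inj₂ xaz∈S =
  sumFree-translate sumFree a∈S xz∈S (subst (_∈ S) (⊕-swapʳ x a (a ⊕ b)) xaz∈S)

-- Step (3): every x ∈ S ∩ (S ⊕ z) is the smaller summand either of (x , x ⊕ z) or of (x ⊕ z , x).
translateInter-≤ : ∀ {r} (S : Subset r) (z : F₂^ r) →
  count (translateInter S z) ≤ count (smallerSummand S z) + count (smallerSummand S z)
translateInter-≤ S z = ≤-trans (count-mono smaller-or-larger) (count-union-translate (smallerSummand S z) z)
  where
  smaller-or-larger : ∀ x → x ∈ translateInter S z →
    T (smallerSummand S z x ∨ smallerSummand S z (x ⊕ z))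
  smaller-or-larger x x∈I rewrite ⊕-cancelʳ x z with S x | S (x ⊕ z)
  ... | true  | true  = ≤ᵇ-total x (x ⊕ z)
  ... | true  | false = ⊥-elim x∈I
  ... | false | _     = ⊥-elim x∈I

-- Step (4): the smaller summands inject into the representations of z, via x ↦ (x , x ⊕ z).
smallerSummand-≤-reps : ∀ {r} (S : Subset r) (z : F₂^ r) → count (smallerSummand S z) ≤ reps S z
smallerSummand-≤-reps {r} S z = begin
  count (smallerSummand S z)  ≤⟨ count-mono representation ⟩
  count isRepresentation      ≡⟨ count-correct isRepresentation ⟩
  ∣ isRepresentation ∣        ≤⟨ filter-graph-≤ _ (_⊕ z) (allVecs r) (allVecs r) (λ x → allVecs-complete r (x ⊕ z)) ⟩
  reps S z                    ∎
  where
  open ≤-Reasoning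
  isRepresentation : Subset r
  isRepresentation x = S x ∧ S (x ⊕ z) ∧ (x ≤ᵇ (x ⊕ z)) ∧ ((x ⊕ (x ⊕ z)) == z)

  representation : ∀ x → x ∈ smallerSummand S z → x ∈ isRepresentation
  representation x x∈small rewrite ⊕-cancelˡ x z with S x | S (x ⊕ z) | x ≤ᵇ (x ⊕ z)
  ... | true  | true  | true  = ==-refl z
  ... | true  | true  | false = ⊥-elim x∈small
  ... | true  | false | _     = ⊥-elim x∈small
  ... | false | _     | _     = ⊥-elim x∈small

halving-bound : ∀ m n s t q → s + s ≡ t + q → t + t ≤ 4 * m → q ≤ n + n → s ≤ m + n
halving-bound m n s t q 2s≡t+q 2t≤4m q≤2n = *-cancelˡ-≤ 4 (begin
  4 * s                              ≡⟨ four-times s ⟩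
  (s + s) + (s + s)                  ≡⟨ cong₂ _+_ 2s≡t+q 2s≡t+q ⟩
  (t + q) + (t + q)                  ≡⟨ interchange t q t q ⟩
  (t + t) + (q + q)                  ≤⟨ +-mono-≤ 2t≤4m (+-mono-≤ q≤2n q≤2n) ⟩
  4 * m + ((n + n) + (n + n))        ≡⟨ cong (4 * m +_) (sym (four-times n)) ⟩
  4 * m + 4 * n                      ≡⟨ sym (*-distribˡ-+ 4 m n) ⟩
  4 * (m + n)                        ∎)
  where
  open ≤-Reasoning
  four-times : ∀ k → 4 * k ≡ (k + k) + (k + k)
  four-times = solve-∀

2^-≤-4*2^∸2 : ∀ r → 2 ^ r ≤ 4 * 2 ^ (r ∸ 2)
2^-≤-4*2^∸2 zero          = s≤s z≤n
2^-≤-4*2^∸2 (suc zero)    = s≤s (s≤s z≤n)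
2^-≤-4*2^∸2 (suc (suc r)) = ≤-reflexive (sym (*-assoc 2 2 (2 ^ r)))

sumFree-bound : ∀ {r} (S : Subset r) → SumFree S → ∀ z → z ∈2 S → ∣ S ∣ ≤ 2 ^ (r ∸ 2) + reps S z
sumFree-bound {r} S sumFree .(a ⊕ b) (a , b , a∈S , b∈S , refl) =
  subst (_≤ 2 ^ (r ∸ 2) + reps S z) (count-correct S)
    (halving-bound (2 ^ (r ∸ 2)) (reps S z) (count S) (count U) (count I) (count-twice S z) U-small I-small)
  where
  z : F₂^ r
  z = a ⊕ b
  U I : Subset r
  U = translateUnion S z
  I = translateInter S z

  U-small : count U + count U ≤ 4 * 2 ^ (r ∸ 2)
  U-small = ≤-trans (count-disjoint-translate U a (translateUnion-disjoint sumFree a∈S b∈S))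
                    (2^-≤-4*2^∸2 r)

  I-small : count I ≤ reps S z + reps S z
  I-small = ≤-trans (translateInter-≤ S z)
                    (+-mono-≤ (smallerSummand-≤-reps S z) (smallerSummand-≤-reps S z))

corollary3p8 : (r κ : ℕ) → 2 ≤ r → 2 ≤ κ → (S : Subset r) → SumFree S →
    2 ^ (r ∸ 2) + κ < ∣ S ∣ → ∀ z → z ∈2 S → κ ≤ reps S z
corollary3p8 r κ _ _ S sumFree large z z∈2S =
  <⇒≤ (+-cancelˡ-< (2 ^ (r ∸ 2)) κ (reps S z) (<-≤-trans large (sumFree-bound S sumFree z z∈2S)))
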